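{- Let $G$ be a connected graph with $n\ge 2$ vertices. Then $$B(G)\ge\frac{Kf(G)^2}{n(n-1)},$$ with equality if and only if $G$ is isomorphic to the complete graph $K_n$.
   Context: All graphs are finite, simple and undirected. The Laplacian matrix of $G$ is $L=D-A$ ($A$ adjacency matrix, $D$ diagonal degree matrix). $L^{+}$ is the Moore–Penrose inverse of $L$ and $L^{2+}=(L^{+})^2$. The biharmonic distance is the nonnegative number $d_B(u,v)$ with $d_B^2(u,v)=L^{2+}_{uu}+L^{2+}_{vv}-2L^{2+}_{uv}$, and the biharmonic index is $B(G)=\frac12\sum_{u\in V(G)}\sum_{v\in V(G)}d_B^2(u,v)$. The resistance distance between vertices $v_i,v_j$ is $r_{ij}=L^{+}_{ii}+L^{+}_{jj}-2L^{+}_{ij}$, and the Kirchhoff index is $Kf(G)=\sum_{i<j}r_{ij}$. -}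

module Defs where

open import Data.Bool using (Bool; true; false; if_then_else_)
open import Data.Nat as ℕ using (ℕ; zero; suc)
open import Data.Fin using (Fin; zero; suc; _<?_)
open import Data.Fin.Properties using (_≟_)
open import Data.Integer using (+_; -[1+_])
open import Data.Rational using (ℚ; 0ℚ; 1ℚ; _+_; _*_; _-_; ½; _/_)
open import Relation.Nullary using (does)
open import Relation.Binary.PropositionalEquality using (_≡_)
open import Function.Bundles using (_↔_; Inverse)
open import Data.Product using (Σ)

Matrix : ℕ → Set
Matrix n = Fin n → Fin n → ℚ

Σ[_] : ∀ {n} → (Fin n → ℚ) → ℚ
Σ[_] {zero} f = 0ℚ
Σ[_] {suc n} f = f zero + Σ[_] (λ i → f (suc i))

_⊗_ : ∀ {n} → Matrix n → Matrix n → Matrix n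
(A ⊗ B) i j = Σ[ (λ k → A i k * B k j) ]

transpose : ∀ {n} → Matrix n → Matrix n
transpose A i j = A j i

record IsMPInverse {n : ℕ} (A X : Matrix n) : Set where
  field
    p1 : ∀ i j → ((A ⊗ X) ⊗ A) i j ≡ A i j
    p2 : ∀ i j → ((X ⊗ A) ⊗ X) i j ≡ X i j
    p3 : ∀ i j → transpose (A ⊗ X) i j ≡ (A ⊗ X) i j
    p4 : ∀ i j → transpose (X ⊗ A) i j ≡ (X ⊗ A) i j

record Graph (n : ℕ) : Set where
  field
    adj    : Fin n → Fin n → Bool
    adj-sym : ∀ u v → adj u v ≡ adj v u
    adj-irrefl : ∀ v → adj v v ≡ false
open Graph public

completeGraph : (n : ℕ) → Graph n
completeGraph n = record
  { adj = λ u v → if does (u ≟ v) then false else true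
  ; adj-sym = symK
  ; adj-irrefl = irrK }
  where
  open import Relation.Binary.PropositionalEquality using (refl; sym)
  open import Relation.Nullary using (yes; no)
  symK : ∀ u v → (if does (u ≟ v) then false else true) ≡ (if does (v ≟ u) then false else true)
  symK u v with u ≟ v | v ≟ u
  ... | yes _ | yes _ = refl
  ... | no _  | no _  = refl
  ... | yes p | no q  = Data.Empty.⊥-elim (q (sym p)) where import Data.Empty
  ... | no p  | yes q = Data.Empty.⊥-elim (p (sym q)) where import Data.Empty
  irrK : ∀ v → (if does (v ≟ v) then false else true) ≡ false
  irrK v with v ≟ v
  ... | yes _ = refl
  ... | no q  = Data.Empty.⊥-elim (q refl) where import Data.Empty

data Walk {n : ℕ} (G : Graph n) : Fin n → Fin n → Set where
  stay : ∀ {v} → Walk G v v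
  step : ∀ {u w v} → adj G u w ≡ true → Walk G w v → Walk G u v

Connected : ∀ {n} → Graph n → Set
Connected {n} G = ∀ (u v : Fin n) → Walk G u v

Isomorphic : ∀ {n} → Graph n → Graph n → Set
Isomorphic {n} G H =
  Σ (Fin n ↔ Fin n) λ σ → ∀ u v → adj G u v ≡ adj H (Inverse.to σ u) (Inverse.to σ v)

degree : ∀ {n} → Graph n → Fin n → ℚ
degree G u = Σ[ (λ v → if adj G u v then 1ℚ else 0ℚ) ]

laplacian : ∀ {n} → Graph n → Matrix n
laplacian G u v =
  if does (u ≟ v) then degree G u else (if adj G u v then (-[1+ 0 ] / 1) else 0ℚ)

-- given L⁺ (argument X), resistance distance and Kirchhoff index
resistance : ∀ {n} → Matrix n → Fin n → Fin n → ℚ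
resistance X i j = X i i + X j j - (+ 2 / 1) * X i j

kirchhoff : ∀ {n} → Matrix n → ℚ
kirchhoff X = Σ[ (λ i → Σ[ (λ j → if does (i <? j) then resistance X i j else 0ℚ) ]) ]

-- squared biharmonic distance (via L^{2+} = (L⁺)²) and biharmonic index
biharmonicSq : ∀ {n} → Matrix n → Fin n → Fin n → ℚ
biharmonicSq X u v = let Y = X ⊗ X in Y u u + Y v v - (+ 2 / 1) * Y u v

biharmonicIndex : ∀ {n} → Matrix n → ℚ
biharmonicIndex X = ½ * Σ[ (λ u → Σ[ (λ v → biharmonicSq X u v) ]) ]

{-# OPTIONS --safe #-}

-- Let X = L⁺ and let E = I − J/n be the centering matrix. Connectivity makes the kernel of L
-- consist of the constants (maximum principle), and with the Penrose equations this forces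
-- LX = XL = E, X symmetric, and X with zero row sums. Hence Kf(G) = n·tr X = n⟨X,E⟩ and
-- B(G) = n·tr X² = n⟨X,X⟩ for the Frobenius inner product, while ⟨E,E⟩ = n − 1: the inequality
-- is Cauchy–Schwarz ⟨X,E⟩² ≤ ⟨E,E⟩⟨X,X⟩. Equality forces (n − 1)X = tr X · E; multiplying by L
-- gives (n − 1)E = tr X · L, so L vanishes at no off-diagonal entry and G is complete.
-- Conversely, for Kₙ one has L = nE, hence X = E/n is proportional to E.

module Submission where

open import Defs
open import Data.Nat as ℕ using (ℕ; suc)
open import Data.Integer using (+_)
open import Data.Rational using (ℚ; _*_; _≤_; _/_)
open import Data.Product using (_×_)
open import Function.Bundles using (_⇔_)
open import Relation.Binary.PropositionalEquality using (_≡_)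

open import Algebra.Bundles using (Ring)
open import Data.Bool using (true; false; if_then_else_)
open import Data.Empty using (⊥-elim)
open import Data.Fin using (Fin; zero; suc) renaming (_<_ to _<ᶠ_)
open import Data.Fin.Properties using (_≟_; _<?_)
import Data.Fin.Properties as Fin
import Data.Integer as ℤ
open import Data.Integer.Tactic.RingSolver renaming (solve-∀ to ℤ-solve-∀)
open import Data.Nat.Coprimality using (1-coprimeTo)
open import Data.Product using (∃; _,_; proj₁; proj₂)
open import Data.Rational
  using (0ℚ; 1ℚ; ½; _+_; _-_; -_; _<_; 1/_; toℚᵘ; Positive; NonNegative; positive; negative; nonNegative; nonPositive)
open import Data.Rational.Literals using (fromℤ)
open import Data.Rational.Properties hiding (_≟_; _<?_)
import Data.Rational.Unnormalised as ℚᵘ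
import Data.Rational.Unnormalised.Properties as ℚᵘ
open import Data.Sum using (inj₁; inj₂)
open import Function.Bundles using (mk⇔; Inverse; Injection)
open import Function.Construct.Identity using (↔-id)
open import Function.Properties.Inverse using (↔⇒↣)
open import Relation.Binary.Definitions using (tri<; tri≈; tri>)
open import Relation.Binary.PropositionalEquality
  using (refl; sym; trans; cong; cong₂; subst; subst₂; _≢_; module ≡-Reasoning)
open import Relation.Nullary using (¬_; does; yes; no)
open import Relation.Nullary.Decidable using (dec⇒maybe; dec-true; dec-false)
open import Tactic.RingSolver using (solve-∀)
open import Tactic.RingSolver.Core.AlmostCommutativeRing using (AlmostCommutativeRing; fromCommutativeRing)
open import Algebra.Properties.Group +-0-group using (x∙y⁻¹≈ε⇒x≈y) renaming (∙-cancelʳ to +-cancelʳ)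
open import Algebra.Properties.Semiring.Sum (Ring.semiring +-*-ring)
  using (sum; sum-cong-≗; ∑-distrib-+; ∑-comm; *-distribˡ-sum)
open import Algebra.Properties.Semiring.Mult (Ring.semiring +-*-ring) using (×1-homo-*) renaming (_×_ to _×ℚ_)

ℚ-ring : AlmostCommutativeRing _ _
ℚ-ring = fromCommutativeRing +-*-commutativeRing (λ x → dec⇒maybe (0ℚ Data.Rational.Properties.≟ x))

toℚ : ℕ → ℚ
toℚ n = n ×ℚ 1ℚ

toℚ-* : ∀ a b → toℚ (a ℕ.* b) ≡ toℚ a * toℚ b
toℚ-* = ×1-homo-*

toℚ-nonNeg : ∀ n → NonNegative (toℚ n)
toℚ-nonNeg ℕ.zero = _
toℚ-nonNeg (suc n) = nonNeg+nonNeg⇒nonNeg 1ℚ (toℚ n) {{toℚ-nonNeg n}}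

toℚ-suc-pos : ∀ n → Positive (toℚ (suc n))
toℚ-suc-pos n = pos+nonNeg⇒pos 1ℚ (toℚ n) {{toℚ-nonNeg n}}

toℚ≡fromℤ : ∀ n → toℚ n ≡ fromℤ (+ n)
toℚ≡fromℤ ℕ.zero   = refl
toℚ≡fromℤ (suc n) = trans (cong (_+_ 1ℚ) (toℚ≡fromℤ n)) (toℚᵘ-injective 1+n≃1+n)
  where
  add-one : ∀ x → (+ 1 ℤ.* + 1 ℤ.+ x ℤ.* + 1) ℤ.* + 1 ≡ (+ 1 ℤ.+ x) ℤ.* (+ 1 ℤ.* + 1)
  add-one = ℤ-solve-∀
  1+n≃1+n : toℚᵘ (1ℚ + fromℤ (+ n)) ℚᵘ.≃ toℚᵘ (fromℤ (+ suc n))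
  1+n≃1+n = ℚᵘ.≃-trans (toℚᵘ-homo-+ 1ℚ (fromℤ (+ n))) (ℚᵘ.*≡* (add-one (+ n)))

-- The literal + 1 / n is normalised; normalize-coprime identifies it with 1/ fromℤ (+ n).
1/n*n≡1 : ∀ n .{{_ : ℕ.NonZero n}} → (+ 1 / n) * toℚ n ≡ 1ℚ
1/n*n≡1 (suc j) = begin
  (+ 1 / suc j) * toℚ (suc j)
    ≡⟨ cong₂ _*_ (normalize-coprime (1-coprimeTo (suc j))) (toℚ≡fromℤ (suc j)) ⟩
  1/ fromℤ (+ suc j) * fromℤ (+ suc j)
    ≡⟨ *-inverseˡ (fromℤ (+ suc j)) ⟩
  1ℚ ∎
  where open ≡-Reasoning

p-q≡0⇒p≡q : ∀ p q → p - q ≡ 0ℚ → p ≡ q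
p-q≡0⇒p≡q = x∙y⁻¹≈ε⇒x≈y

*-cancelˡ-≡-pos : ∀ r .{{_ : Positive r}} {p q} → r * p ≡ r * q → p ≡ q
*-cancelˡ-≡-pos r rp≡rq =
  ≤-antisym (*-cancelˡ-≤-pos r (≤-reflexive rp≡rq)) (*-cancelˡ-≤-pos r (≤-reflexive (sym rp≡rq)))

+-nonNeg-≡0ˡ : ∀ {p q} → 0ℚ ≤ p → 0ℚ ≤ q → p + q ≡ 0ℚ → p ≡ 0ℚ
+-nonNeg-≡0ˡ {p} {q} p≥0 q≥0 p+q≡0 = ≤-antisym p≤0 p≥0
  where
  open ≤-Reasoning
  p≤0 : p ≤ 0ℚ
  p≤0 = begin
    p       ≡⟨ sym (+-identityʳ p) ⟩
    p + 0ℚ  ≤⟨ +-monoʳ-≤ p q≥0 ⟩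
    p + q   ≡⟨ p+q≡0 ⟩
    0ℚ      ∎

*-nonNeg : ∀ {p q} → 0ℚ ≤ p → 0ℚ ≤ q → 0ℚ ≤ p * q
*-nonNeg {p} {q} p≥0 q≥0 = nonNegative⁻¹ _ {{nonNeg*nonNeg⇒nonNeg p {{nonNegative p≥0}} q {{nonNegative q≥0}}}}

p≤q⇒0≤q-p : ∀ {p q} → p ≤ q → 0ℚ ≤ q - p
p≤q⇒0≤q-p {p} {q} p≤q = begin
  0ℚ     ≡⟨ sym (+-inverseʳ p) ⟩
  p - p  ≤⟨ +-monoˡ-≤ (- p) p≤q ⟩
  q - p  ∎
  where open ≤-Reasoning

p-q≡p⇒q≡0 : ∀ p q → p - q ≡ p → q ≡ 0ℚ
p-q≡p⇒q≡0 p q p-q≡p = trans (subtract-twice p q) (trans (cong (λ x → p - x) p-q≡p) (+-inverseʳ p))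
  where
  subtract-twice : ∀ p q → q ≡ p - (p - q)
  subtract-twice = solve-∀ ℚ-ring

-- Despite its name, nonPos*nonPos⇒nonPos concludes NonNegative.
square-nonNeg : ∀ p → 0ℚ ≤ p * p
square-nonNeg p with ≤-total 0ℚ p
... | inj₁ 0≤p = *-nonNeg 0≤p 0≤p
... | inj₂ p≤0 = nonNegative⁻¹ _ {{nonPos*nonPos⇒nonPos p {{nonPositive p≤0}} p {{nonPositive p≤0}}}}

square≡0⇒≡0 : ∀ p → p * p ≡ 0ℚ → p ≡ 0ℚ
square≡0⇒≡0 p pp≡0 with <-cmp p 0ℚ
... | tri< p<0 _ _ = ⊥-elim (<-irrefl (sym pp≡0) (positive⁻¹ _ {{neg*neg⇒pos p {{negative p<0}} p {{negative p<0}}}}))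
... | tri≈ _ p≡0 _ = p≡0
... | tri> _ _ p>0 = ⊥-elim (<-irrefl (sym pp≡0) (positive⁻¹ _ {{pos*pos⇒pos p {{positive p>0}} p {{positive p>0}}}}))

halve : ∀ {p q} → p + p ≡ q + q → p ≡ q
halve {p} {q} p+p≡q+q = trans (half p) (trans (cong (½ *_) p+p≡q+q) (sym (half q)))
  where
  half : ∀ x → x ≡ ½ * (x + x)
  half = solve-∀ ℚ-ring

Σ≡sum : ∀ {n} (f : Fin n → ℚ) → Σ[ f ] ≡ sum f
Σ≡sum {ℕ.zero} f = refl
Σ≡sum {suc n} f = cong (_+_ (f zero)) (Σ≡sum (λ i → f (suc i)))

Σ-cong : ∀ {n} {f g : Fin n → ℚ} → (∀ i → f i ≡ g i) → Σ[ f ] ≡ Σ[ g ]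
Σ-cong {f = f} {g} f≗g = trans (Σ≡sum f) (trans (sum-cong-≗ f≗g) (sym (Σ≡sum g)))

Σ-distrib-+ : ∀ {n} (f g : Fin n → ℚ) → Σ[ (λ i → f i + g i) ] ≡ Σ[ f ] + Σ[ g ]
Σ-distrib-+ f g = trans (Σ≡sum (λ i → f i + g i)) (trans (∑-distrib-+ f g) (sym (cong₂ _+_ (Σ≡sum f) (Σ≡sum g))))

*-distribˡ-Σ : ∀ {n} c (f : Fin n → ℚ) → c * Σ[ f ] ≡ Σ[ (λ i → c * f i) ]
*-distribˡ-Σ c f = trans (cong (c *_) (Σ≡sum f)) (trans (*-distribˡ-sum c f) (sym (Σ≡sum (λ i → c * f i))))

*-distribʳ-Σ : ∀ {n} c (f : Fin n → ℚ) → Σ[ f ] * c ≡ Σ[ (λ i → f i * c) ]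
*-distribʳ-Σ c f = trans (*-comm _ c) (trans (*-distribˡ-Σ c f) (Σ-cong (λ i → *-comm c (f i))))

Σ-comm : ∀ {m n} (f : Fin m → Fin n → ℚ) → Σ[ (λ i → Σ[ f i ]) ] ≡ Σ[ (λ j → Σ[ (λ i → f i j) ]) ]
Σ-comm f = trans (Σ²≡sum² f) (trans (∑-comm f) (sym (Σ²≡sum² (λ j i → f i j))))
  where
  Σ²≡sum² : ∀ {m n} (g : Fin m → Fin n → ℚ) → Σ[ (λ i → Σ[ g i ]) ] ≡ sum (λ i → sum (g i))
  Σ²≡sum² g = trans (Σ-cong (λ i → Σ≡sum (g i))) (Σ≡sum (λ i → sum (g i)))

Σ-linear : ∀ {n} a b (f g : Fin n → ℚ) → Σ[ (λ i → a * f i - b * g i) ] ≡ a * Σ[ f ] - b * Σ[ g ]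
Σ-linear a b f g = begin
  Σ[ (λ i → a * f i - b * g i) ]
    ≡⟨ Σ-cong (λ i → as-sum a b (f i) (g i)) ⟩
  Σ[ (λ i → a * f i + (- b) * g i) ]
    ≡⟨ Σ-distrib-+ (λ i → a * f i) (λ i → (- b) * g i) ⟩
  Σ[ (λ i → a * f i) ] + Σ[ (λ i → (- b) * g i) ]
    ≡⟨ sym (cong₂ _+_ (*-distribˡ-Σ a f) (*-distribˡ-Σ (- b) g)) ⟩
  a * Σ[ f ] + (- b) * Σ[ g ]
    ≡⟨ sym (as-sum a b Σ[ f ] Σ[ g ]) ⟩
  a * Σ[ f ] - b * Σ[ g ] ∎
  where
  open ≡-Reasoning
  as-sum : ∀ a b x y → a * x - b * y ≡ a * x + (- b) * y
  as-sum = solve-∀ ℚ-ring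

Σ-distrib-- : ∀ {n} (f g : Fin n → ℚ) → Σ[ (λ i → f i - g i) ] ≡ Σ[ f ] - Σ[ g ]
Σ-distrib-- f g = trans (Σ-cong (λ i → unit (f i) (g i))) (trans (Σ-linear 1ℚ 1ℚ f g) (sym (unit Σ[ f ] Σ[ g ])))
  where
  unit : ∀ x y → x - y ≡ 1ℚ * x - 1ℚ * y
  unit = solve-∀ ℚ-ring

Σ-const : ∀ {n} c → Σ[ (λ (_ : Fin n) → c) ] ≡ toℚ n * c
Σ-const {ℕ.zero} c = sym (*-zeroˡ c)
Σ-const {suc n} c = trans (cong (_+_ c) (Σ-const {n} c)) (distrib-suc c (toℚ n))
  where
  distrib-suc : ∀ c t → c + t * c ≡ (1ℚ + t) * c
  distrib-suc = solve-∀ ℚ-ring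

Σ-zero : ∀ {n} {f : Fin n → ℚ} → (∀ i → f i ≡ 0ℚ) → Σ[ f ] ≡ 0ℚ
Σ-zero {n} f≗0 = trans (Σ-cong f≗0) (trans (Σ-const {n} 0ℚ) (*-zeroʳ (toℚ n)))

Σ-nonNeg : ∀ {n} (f : Fin n → ℚ) → (∀ i → 0ℚ ≤ f i) → 0ℚ ≤ Σ[ f ]
Σ-nonNeg {ℕ.zero} f f≥0 = ≤-refl
Σ-nonNeg {suc n} f f≥0 = +-mono-≤ (f≥0 zero) (Σ-nonNeg _ (λ i → f≥0 (suc i)))

Σ-nonNeg-≡0 : ∀ {n} (f : Fin n → ℚ) → (∀ i → 0ℚ ≤ f i) → Σ[ f ] ≡ 0ℚ → ∀ i → f i ≡ 0ℚ
Σ-nonNeg-≡0 f f≥0 Σf≡0 zero = +-nonNeg-≡0ˡ (f≥0 zero) (Σ-nonNeg _ (λ i → f≥0 (suc i))) Σf≡0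
Σ-nonNeg-≡0 f f≥0 Σf≡0 (suc i) = Σ-nonNeg-≡0 _ (λ j → f≥0 (suc j)) rest≡0 i
  where
  rest≡0 : Σ[ (λ j → f (suc j)) ] ≡ 0ℚ
  rest≡0 = +-nonNeg-≡0ˡ (Σ-nonNeg _ (λ j → f≥0 (suc j))) (f≥0 zero)
                        (trans (+-comm (Σ[ (λ j → f (suc j)) ]) (f zero)) Σf≡0)

δ : ∀ {n} → Fin n → Fin n → ℚ
δ i j = if does (i ≟ j) then 1ℚ else 0ℚ

δ-sym : ∀ {n} (i j : Fin n) → δ i j ≡ δ j i
δ-sym i j with i ≟ j | j ≟ i
... | yes _   | yes _   = refl
... | no _    | no _    = refl
... | yes i≡j | no j≢i  = ⊥-elim (j≢i (sym i≡j))
... | no i≢j  | yes j≡i = ⊥-elim (i≢j (sym j≡i))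

δ-diag : ∀ {n} (i : Fin n) → δ i i ≡ 1ℚ
δ-diag i with i ≟ i
... | yes _  = refl
... | no i≢i = ⊥-elim (i≢i refl)

δ-offdiag : ∀ {n} {i j : Fin n} → i ≢ j → δ i j ≡ 0ℚ
δ-offdiag {i = i} {j} i≢j with i ≟ j
... | yes i≡j = ⊥-elim (i≢j i≡j)
... | no _    = refl

Σ-δˡ : ∀ {n} (i : Fin n) (f : Fin n → ℚ) → Σ[ (λ j → δ i j * f j) ] ≡ f i
Σ-δˡ zero f = trans (cong₂ _+_ (*-identityˡ (f zero)) (Σ-zero (λ j → *-zeroˡ (f (suc j))))) (+-identityʳ (f zero))
Σ-δˡ (suc i) f = trans (cong₂ _+_ (*-zeroˡ (f zero)) (Σ-δˡ i (λ j → f (suc j)))) (+-identityˡ (f (suc i)))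

Σ-δʳ : ∀ {n} (i : Fin n) (f : Fin n → ℚ) → Σ[ (λ j → f j * δ j i) ] ≡ f i
Σ-δʳ i f = trans (Σ-cong (λ j → trans (*-comm (f j) (δ j i)) (cong (_* f j) (δ-sym j i)))) (Σ-δˡ i f)

Σ-δ : ∀ {n} (i : Fin n) → Σ[ δ i ] ≡ 1ℚ
Σ-δ i = trans (Σ-cong (λ j → sym (*-identityʳ (δ i j)))) (Σ-δˡ i (λ _ → 1ℚ))

Symmetric : ∀ {n} → Matrix n → Set
Symmetric M = ∀ i j → M i j ≡ M j i

ZeroRowSums : ∀ {n} → Matrix n → Set
ZeroRowSums M = ∀ i → Σ[ M i ] ≡ 0ℚ

trace : ∀ {n} → Matrix n → ℚ
trace M = Σ[ (λ i → M i i) ]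

Σ² : ∀ {n} → Matrix n → ℚ
Σ² M = Σ[ (λ i → Σ[ M i ]) ]

⟪_,_⟫ : ∀ {n} → Matrix n → Matrix n → ℚ
⟪ U , V ⟫ = Σ² (λ i j → U i j * V i j)

symmetric∧zeroColSums⇒zeroRowSums : ∀ {n} {M : Matrix n} → Symmetric M → ZeroRowSums (transpose M) → ZeroRowSums M
symmetric∧zeroColSums⇒zeroRowSums M-sym colSums≡0 i = trans (Σ-cong (M-sym i)) (colSums≡0 i)

⊗-assoc : ∀ {n} (A B C : Matrix n) i j → ((A ⊗ B) ⊗ C) i j ≡ (A ⊗ (B ⊗ C)) i j
⊗-assoc A B C i j = begin
  Σ[ (λ l → Σ[ (λ k → A i k * B k l) ] * C l j) ]
    ≡⟨ Σ-cong (λ l → *-distribʳ-Σ (C l j) (λ k → A i k * B k l)) ⟩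
  Σ[ (λ l → Σ[ (λ k → A i k * B k l * C l j) ]) ]
    ≡⟨ Σ-comm (λ l k → A i k * B k l * C l j) ⟩
  Σ[ (λ k → Σ[ (λ l → A i k * B k l * C l j) ]) ]
    ≡⟨ Σ-cong (λ k → Σ-cong (λ l → *-assoc (A i k) (B k l) (C l j))) ⟩
  Σ[ (λ k → Σ[ (λ l → A i k * (B k l * C l j)) ]) ]
    ≡⟨ Σ-cong (λ k → sym (*-distribˡ-Σ (A i k) (λ l → B k l * C l j))) ⟩
  Σ[ (λ k → A i k * Σ[ (λ l → B k l * C l j) ]) ] ∎
  where open ≡-Reasoning

transpose-⊗ : ∀ {n} (A B : Matrix n) i j → transpose (A ⊗ B) i j ≡ (transpose B ⊗ transpose A) i j
transpose-⊗ A B i j = Σ-cong (λ l → *-comm (A j l) (B l i))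

⊗-cong : ∀ {n} {A A′ B B′ : Matrix n} → (∀ i j → A i j ≡ A′ i j) → (∀ i j → B i j ≡ B′ i j) →
  ∀ i j → (A ⊗ B) i j ≡ (A′ ⊗ B′) i j
⊗-cong A≗A′ B≗B′ i j = Σ-cong (λ l → cong₂ _*_ (A≗A′ i l) (B≗B′ l j))

⊗-scaleˡ : ∀ {n} c (A B : Matrix n) i j → ((λ i j → c * A i j) ⊗ B) i j ≡ c * (A ⊗ B) i j
⊗-scaleˡ c A B i j = trans (Σ-cong (λ l → *-assoc c (A i l) (B l j))) (sym (*-distribˡ-Σ c (λ l → A i l * B l j)))

⊗-scaleʳ : ∀ {n} c (A B : Matrix n) i j → (A ⊗ (λ i j → c * B i j)) i j ≡ c * (A ⊗ B) i j
⊗-scaleʳ c A B i j = trans (Σ-cong (λ l → swap (A i l) c (B l j))) (sym (*-distribˡ-Σ c (λ l → A i l * B l j)))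
  where
  swap : ∀ a c b → a * (c * b) ≡ c * (a * b)
  swap = solve-∀ ℚ-ring

⊗-swap-symmetric : ∀ {n} {A B : Matrix n} → Symmetric A → Symmetric B → ∀ i j → (A ⊗ B) i j ≡ (B ⊗ A) j i
⊗-swap-symmetric {A = A} {B} A-sym B-sym i j =
  Σ-cong (λ l → trans (cong₂ _*_ (A-sym i l) (B-sym l j)) (*-comm (A l i) (B j l)))

⊗-zeroRowSums : ∀ {n} (A B : Matrix n) → ZeroRowSums B → ZeroRowSums (A ⊗ B)
⊗-zeroRowSums A B rowSums≡0 i = begin
  Σ[ (λ j → Σ[ (λ l → A i l * B l j) ]) ]
    ≡⟨ Σ-comm (λ j l → A i l * B l j) ⟩
  Σ[ (λ l → Σ[ (λ j → A i l * B l j) ]) ]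
    ≡⟨ Σ-cong (λ l → sym (*-distribˡ-Σ (A i l) (B l))) ⟩
  Σ[ (λ l → A i l * Σ[ B l ]) ]
    ≡⟨ Σ-zero (λ l → trans (cong (A i l *_) (rowSums≡0 l)) (*-zeroʳ (A i l))) ⟩
  0ℚ ∎
  where open ≡-Reasoning

⊗-zeroColSums : ∀ {n} (A B : Matrix n) → ZeroRowSums (transpose A) → ZeroRowSums (transpose (A ⊗ B))
⊗-zeroColSums A B colSums≡0 j =
  trans (Σ-cong (transpose-⊗ A B j)) (⊗-zeroRowSums (transpose B) (transpose A) colSums≡0 j)

⟪⟫≡trace-⊗ : ∀ {n} (U : Matrix n) {V : Matrix n} → Symmetric V → ⟪ U , V ⟫ ≡ trace (U ⊗ V)
⟪⟫≡trace-⊗ U V-sym = Σ-cong (λ i → Σ-cong (λ j → cong (U i j *_) (V-sym i j)))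

-- The centering matrix E = I − J/n

1/[1+_] : ℕ → ℚ
1/[1+ m ] = (1/ toℚ (suc m)) {{pos⇒nonZero (toℚ (suc m)) {{toℚ-suc-pos m}}}}

1/[1+]-pos : ∀ m → Positive 1/[1+ m ]
1/[1+]-pos m = 1/pos⇒pos (toℚ (suc m)) {{toℚ-suc-pos m}}

toℚ-suc*1/[1+] : ∀ m → toℚ (suc m) * 1/[1+ m ] ≡ 1ℚ
toℚ-suc*1/[1+] m = *-inverseʳ (toℚ (suc m)) {{pos⇒nonZero (toℚ (suc m)) {{toℚ-suc-pos m}}}}

centering : ∀ {m} → Matrix (suc m)
centering {m} i j = δ i j - 1/[1+ m ]

module _ {m : ℕ} where

  private
    w : ℚ
    w = 1/[1+ m ]

  centering-symmetric : Symmetric (centering {m})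
  centering-symmetric i j = cong (_- w) (δ-sym i j)

  ⊗-centering : ∀ (M : Matrix (suc m)) i j → (M ⊗ centering) i j ≡ M i j - 1/[1+ m ] * Σ[ M i ]
  ⊗-centering M i j = begin
    Σ[ (λ l → M i l * (δ l j - w)) ]
      ≡⟨ Σ-cong (λ l → expand (M i l) (δ l j) w) ⟩
    Σ[ (λ l → 1ℚ * (M i l * δ l j) - w * M i l) ]
      ≡⟨ Σ-linear 1ℚ w (λ l → M i l * δ l j) (M i) ⟩
    1ℚ * Σ[ (λ l → M i l * δ l j) ] - w * Σ[ M i ]
      ≡⟨ cong (λ x → x - w * Σ[ M i ]) (trans (*-identityˡ _) (Σ-δʳ j (M i))) ⟩
    M i j - w * Σ[ M i ] ∎
    where
    open ≡-Reasoning
    expand : ∀ x d w → x * (d - w) ≡ 1ℚ * (x * d) - w * x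
    expand = solve-∀ ℚ-ring

  centering-⊗ : ∀ (M : Matrix (suc m)) i j → (centering ⊗ M) i j ≡ M i j - 1/[1+ m ] * Σ[ (λ l → M l j) ]
  centering-⊗ M i j = begin
    Σ[ (λ l → (δ i l - w) * M l j) ]
      ≡⟨ Σ-cong (λ l → expand (δ i l) w (M l j)) ⟩
    Σ[ (λ l → 1ℚ * (δ i l * M l j) - w * M l j) ]
      ≡⟨ Σ-linear 1ℚ w (λ l → δ i l * M l j) (λ l → M l j) ⟩
    1ℚ * Σ[ (λ l → δ i l * M l j) ] - w * Σ[ (λ l → M l j) ]
      ≡⟨ cong (λ x → x - w * Σ[ (λ l → M l j) ]) (trans (*-identityˡ _) (Σ-δˡ i (λ l → M l j))) ⟩
    M i j - w * Σ[ (λ l → M l j) ] ∎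
    where
    open ≡-Reasoning
    expand : ∀ d w x → (d - w) * x ≡ 1ℚ * (d * x) - w * x
    expand = solve-∀ ℚ-ring

  centering-zeroRowSums : ZeroRowSums (centering {m})
  centering-zeroRowSums i = begin
    Σ[ (λ j → δ i j - w) ]
      ≡⟨ Σ-cong {suc m} (λ j → expand (δ i j) w) ⟩
    Σ[ (λ j → 1ℚ * δ i j - w * 1ℚ) ]
      ≡⟨ Σ-linear 1ℚ w (δ i) (λ _ → 1ℚ) ⟩
    1ℚ * Σ[ δ i ] - w * Σ[ (λ (_ : Fin (suc m)) → 1ℚ) ]
      ≡⟨ cong₂ (λ x y → 1ℚ * x - w * y) (Σ-δ i) (Σ-const {suc m} 1ℚ) ⟩
    1ℚ * 1ℚ - w * (toℚ (suc m) * 1ℚ)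
      ≡⟨ collect w (toℚ (suc m)) ⟩
    1ℚ - toℚ (suc m) * w
      ≡⟨ cong (λ x → 1ℚ - x) (toℚ-suc*1/[1+] m) ⟩
    1ℚ - 1ℚ
      ≡⟨ +-inverseʳ 1ℚ ⟩
    0ℚ ∎
    where
    open ≡-Reasoning
    expand : ∀ d w → d - w ≡ 1ℚ * d - w * 1ℚ
    expand = solve-∀ ℚ-ring
    collect : ∀ w n → 1ℚ * 1ℚ - w * (n * 1ℚ) ≡ 1ℚ - n * w
    collect = solve-∀ ℚ-ring

  trace-centering : trace (centering {m}) ≡ toℚ m
  trace-centering = begin
    Σ[ (λ (i : Fin (suc m)) → δ i i - w) ]  ≡⟨ Σ-cong {suc m} (λ i → cong (_- w) (δ-diag i)) ⟩
    Σ[ (λ (_ : Fin (suc m)) → 1ℚ - w) ]     ≡⟨ Σ-const {suc m} (1ℚ - w) ⟩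
    (1ℚ + toℚ m) * (1ℚ - w)                 ≡⟨ expand (toℚ m) w ⟩
    toℚ m + (1ℚ - (1ℚ + toℚ m) * w)         ≡⟨ cong (λ x → toℚ m + (1ℚ - x)) (toℚ-suc*1/[1+] m) ⟩
    toℚ m + (1ℚ - 1ℚ)                       ≡⟨ cong (λ x → toℚ m + x) (+-inverseʳ 1ℚ) ⟩
    toℚ m + 0ℚ                              ≡⟨ +-identityʳ (toℚ m) ⟩
    toℚ m                                   ∎
    where
    open ≡-Reasoning
    expand : ∀ t w → (1ℚ + t) * (1ℚ - w) ≡ t + (1ℚ - (1ℚ + t) * w)
    expand = solve-∀ ℚ-ring

  ⊗-centering-zeroRowSums : ∀ {M : Matrix (suc m)} → ZeroRowSums M → ∀ i j → (M ⊗ centering) i j ≡ M i j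
  ⊗-centering-zeroRowSums {M} rowSums≡0 i j =
    trans (⊗-centering M i j) (trans (cong (λ s → M i j - w * s) (rowSums≡0 i)) (drop (M i j) w))
    where
    drop : ∀ x w → x - w * 0ℚ ≡ x
    drop = solve-∀ ℚ-ring

  ⟪⟫-centering : ∀ {M : Matrix (suc m)} → ZeroRowSums M → ⟪ M , centering ⟫ ≡ trace M
  ⟪⟫-centering {M} rowSums≡0 =
    trans (⟪⟫≡trace-⊗ M centering-symmetric) (Σ-cong (λ i → ⊗-centering-zeroRowSums {M} rowSums≡0 i i))

  ⟪centering,centering⟫ : ⟪ centering {m} , centering ⟫ ≡ toℚ m
  ⟪centering,centering⟫ = trans (⟪⟫-centering {centering} centering-zeroRowSums) trace-centering

-- Cauchy–Schwarz for the Frobenius inner product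

⟪⟫-comm : ∀ {n} (U V : Matrix n) → ⟪ U , V ⟫ ≡ ⟪ V , U ⟫
⟪⟫-comm U V = Σ-cong (λ i → Σ-cong (λ j → *-comm (U i j) (V i j)))

⟪⟫-congˡ : ∀ {n} {U U′ : Matrix n} (W : Matrix n) → (∀ i j → U i j ≡ U′ i j) → ⟪ U , W ⟫ ≡ ⟪ U′ , W ⟫
⟪⟫-congˡ W U≗U′ = Σ-cong (λ i → Σ-cong (λ j → cong (_* W i j) (U≗U′ i j)))

⟪⟫-scaleˡ : ∀ {n} c (U W : Matrix n) → ⟪ (λ i j → c * U i j) , W ⟫ ≡ c * ⟪ U , W ⟫
⟪⟫-scaleˡ c U W = begin
  Σ[ (λ i → Σ[ (λ j → c * U i j * W i j) ]) ]   ≡⟨ Σ-cong (λ i → Σ-cong (λ j → *-assoc c (U i j) (W i j))) ⟩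
  Σ[ (λ i → Σ[ (λ j → c * (U i j * W i j)) ]) ] ≡⟨ Σ-cong (λ i → sym (*-distribˡ-Σ c (λ j → U i j * W i j))) ⟩
  Σ[ (λ i → c * Σ[ (λ j → U i j * W i j) ]) ]   ≡⟨ sym (*-distribˡ-Σ c (λ i → Σ[ (λ j → U i j * W i j) ])) ⟩
  c * ⟪ U , W ⟫                                 ∎
  where open ≡-Reasoning

⟪⟫-linearˡ : ∀ {n} a b (U V W : Matrix n) →
  ⟪ (λ i j → a * U i j - b * V i j) , W ⟫ ≡ a * ⟪ U , W ⟫ - b * ⟪ V , W ⟫
⟪⟫-linearˡ a b U V W =
  trans (Σ-cong row) (Σ-linear a b (λ i → Σ[ (λ j → U i j * W i j) ]) (λ i → Σ[ (λ j → V i j * W i j) ]))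
  where
  distrib : ∀ a b u v w → (a * u - b * v) * w ≡ a * (u * w) - b * (v * w)
  distrib = solve-∀ ℚ-ring
  row : ∀ i → Σ[ (λ j → (a * U i j - b * V i j) * W i j) ]
            ≡ a * Σ[ (λ j → U i j * W i j) ] - b * Σ[ (λ j → V i j * W i j) ]
  row i = trans (Σ-cong (λ j → distrib a b (U i j) (V i j) (W i j)))
                (Σ-linear a b (λ j → U i j * W i j) (λ j → V i j * W i j))

⟪⟫-nonNeg : ∀ {n} (U : Matrix n) → 0ℚ ≤ ⟪ U , U ⟫
⟪⟫-nonNeg U = Σ-nonNeg _ (λ i → Σ-nonNeg _ (λ j → square-nonNeg (U i j)))

⟪⟫≡0⇒≡0 : ∀ {n} (U : Matrix n) → ⟪ U , U ⟫ ≡ 0ℚ → ∀ i j → U i j ≡ 0ℚ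
⟪⟫≡0⇒≡0 U ⟪U,U⟫≡0 i j = square≡0⇒≡0 (U i j) (Σ-nonNeg-≡0 _ (λ j → square-nonNeg (U i j)) row≡0 j)
  where
  row≡0 : Σ[ (λ j → U i j * U i j) ] ≡ 0ℚ
  row≡0 = Σ-nonNeg-≡0 _ (λ i → Σ-nonNeg _ (λ j → square-nonNeg (U i j))) ⟪U,U⟫≡0 i

lagrange-identity : ∀ {n} (U V : Matrix n) →
  ⟪ (λ i j → ⟪ V , V ⟫ * U i j - ⟪ U , V ⟫ * V i j) , (λ i j → ⟪ V , V ⟫ * U i j - ⟪ U , V ⟫ * V i j) ⟫
    + ⟪ V , V ⟫ * (⟪ U , V ⟫ * ⟪ U , V ⟫) ≡ ⟪ V , V ⟫ * (⟪ V , V ⟫ * ⟪ U , U ⟫)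
lagrange-identity U V = begin
  ⟪ W , W ⟫ + b * (a * a)
    ≡⟨ cong (_+ b * (a * a)) (⟪⟫-linearˡ b a U V W) ⟩
  b * ⟪ U , W ⟫ - a * ⟪ V , W ⟫ + b * (a * a)
    ≡⟨ cong₂ (λ x y → b * x - a * y + b * (a * a)) (expandU) (expandV) ⟩
  b * (b * ⟪ U , U ⟫ - a * a) - a * (b * a - a * b) + b * (a * a)
    ≡⟨ cancel b a ⟪ U , U ⟫ ⟩
  b * (b * ⟪ U , U ⟫) ∎
  where
  open ≡-Reasoning
  a b : ℚ
  a = ⟪ U , V ⟫
  b = ⟪ V , V ⟫
  W : Matrix _
  W i j = b * U i j - a * V i j
  expandU : ⟪ U , W ⟫ ≡ b * ⟪ U , U ⟫ - a * a
  expandU = trans (⟪⟫-comm U W) (trans (⟪⟫-linearˡ b a U V U) (cong (λ x → b * ⟪ U , U ⟫ - a * x) (⟪⟫-comm V U)))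
  expandV : ⟪ V , W ⟫ ≡ b * a - a * b
  expandV = trans (⟪⟫-comm V W) (⟪⟫-linearˡ b a U V V)
  cancel : ∀ b a f → b * (b * f - a * a) - a * (b * a - a * b) + b * (a * a) ≡ b * (b * f)
  cancel = solve-∀ ℚ-ring

cauchy-schwarz : ∀ {n} (U V : Matrix n) → 0ℚ < ⟪ V , V ⟫ → ⟪ U , V ⟫ * ⟪ U , V ⟫ ≤ ⟪ V , V ⟫ * ⟪ U , U ⟫
cauchy-schwarz U V 0<b = *-cancelˡ-≤-pos ⟪ V , V ⟫ {{positive 0<b}} (begin
  ⟪ V , V ⟫ * (⟪ U , V ⟫ * ⟪ U , V ⟫)        ≡⟨ sym (+-identityˡ _) ⟩
  0ℚ + ⟪ V , V ⟫ * (⟪ U , V ⟫ * ⟪ U , V ⟫)   ≤⟨ +-monoˡ-≤ _ (⟪⟫-nonNeg W) ⟩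
  ⟪ W , W ⟫ + ⟪ V , V ⟫ * (⟪ U , V ⟫ * ⟪ U , V ⟫) ≡⟨ lagrange-identity U V ⟩
  ⟪ V , V ⟫ * (⟪ V , V ⟫ * ⟪ U , U ⟫)        ∎)
  where
  open ≤-Reasoning
  W : Matrix _
  W i j = ⟪ V , V ⟫ * U i j - ⟪ U , V ⟫ * V i j

cauchy-schwarz-≡ : ∀ {n} (U V : Matrix n) → ⟪ U , V ⟫ * ⟪ U , V ⟫ ≡ ⟪ V , V ⟫ * ⟪ U , U ⟫ →
  ∀ i j → ⟪ V , V ⟫ * U i j ≡ ⟪ U , V ⟫ * V i j
cauchy-schwarz-≡ U V a²≡bF i j = p-q≡0⇒p≡q _ _ (⟪⟫≡0⇒≡0 W ⟪W,W⟫≡0 i j)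
  where
  W : Matrix _
  W i j = ⟪ V , V ⟫ * U i j - ⟪ U , V ⟫ * V i j
  ba² : ℚ
  ba² = ⟪ V , V ⟫ * (⟪ U , V ⟫ * ⟪ U , V ⟫)
  ⟪W,W⟫≡0 : ⟪ W , W ⟫ ≡ 0ℚ
  ⟪W,W⟫≡0 = +-cancelʳ ba² ⟪ W , W ⟫ 0ℚ
    (trans (lagrange-identity U V) (trans (cong (⟪ V , V ⟫ *_) (sym a²≡bF)) (sym (+-identityˡ ba²))))

cauchy-schwarz-proportional : ∀ {n} c (U V : Matrix n) → (∀ i j → U i j ≡ c * V i j) →
  ⟪ U , V ⟫ * ⟪ U , V ⟫ ≡ ⟪ V , V ⟫ * ⟪ U , U ⟫
cauchy-schwarz-proportional c U V U≡cV = begin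
  ⟪ U , V ⟫ * ⟪ U , V ⟫               ≡⟨ cong (λ x → x * x) ⟪U,V⟫≡cb ⟩
  (c * ⟪ V , V ⟫) * (c * ⟪ V , V ⟫)   ≡⟨ rearrange c ⟪ V , V ⟫ ⟩
  ⟪ V , V ⟫ * (c * (c * ⟪ V , V ⟫))   ≡⟨ cong (λ x → ⟪ V , V ⟫ * (c * x)) (sym ⟪U,V⟫≡cb) ⟩
  ⟪ V , V ⟫ * (c * ⟪ U , V ⟫)         ≡⟨ cong (⟪ V , V ⟫ *_) (sym ⟪U,U⟫≡c⟪U,V⟫) ⟩
  ⟪ V , V ⟫ * ⟪ U , U ⟫               ∎
  where
  open ≡-Reasoning
  ⟪U,V⟫≡cb : ⟪ U , V ⟫ ≡ c * ⟪ V , V ⟫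
  ⟪U,V⟫≡cb = trans (⟪⟫-congˡ V U≡cV) (⟪⟫-scaleˡ c V V)
  ⟪U,U⟫≡c⟪U,V⟫ : ⟪ U , U ⟫ ≡ c * ⟪ U , V ⟫
  ⟪U,U⟫≡c⟪U,V⟫ = trans (⟪⟫-congˡ U U≡cV) (trans (⟪⟫-scaleˡ c V U) (cong (c *_) (⟪⟫-comm V U)))
  rearrange : ∀ c b → (c * b) * (c * b) ≡ b * (c * (c * b))
  rearrange = solve-∀ ℚ-ring

-- Graph Laplacians

module Laplacian {n : ℕ} (G : Graph n) where

  L : Matrix n
  L = laplacian G

  A : Matrix n
  A u v = if adj G u v then 1ℚ else 0ℚ

  adjacency-nonNeg : ∀ u v → 0ℚ ≤ A u v
  adjacency-nonNeg u v with adj G u v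
  ... | true  = nonNegative⁻¹ 1ℚ
  ... | false = ≤-refl

  laplacian-entry : ∀ u v → L u v ≡ degree G u * δ u v - A u v
  laplacian-entry u v with u ≟ v
  ... | yes refl rewrite adj-irrefl G u = diagonal (degree G u)
    where
    diagonal : ∀ d → d ≡ d * 1ℚ - 0ℚ
    diagonal = solve-∀ ℚ-ring
  ... | no _ with adj G u v
  ...   | true  = off-diagonal (degree G u)
    where
    off-diagonal : ∀ d → - 1ℚ ≡ d * 0ℚ - 1ℚ
    off-diagonal = solve-∀ ℚ-ring
  ...   | false = sym (zero-diagonal (degree G u))
    where
    zero-diagonal : ∀ d → d * 0ℚ - 0ℚ ≡ 0ℚ
    zero-diagonal = solve-∀ ℚ-ring

  degree-δ-sym : ∀ u v → degree G u * δ u v ≡ degree G v * δ v u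
  degree-δ-sym u v with u ≟ v
  ... | yes refl = cong (degree G u *_) (sym (δ-diag u))
  ... | no u≢v   =
    trans (*-zeroʳ (degree G u))
          (sym (trans (cong (degree G v *_) (δ-offdiag (λ v≡u → u≢v (sym v≡u)))) (*-zeroʳ (degree G v))))

  laplacian-symmetric : Symmetric L
  laplacian-symmetric u v = begin
    L u v
      ≡⟨ laplacian-entry u v ⟩
    degree G u * δ u v - A u v
      ≡⟨ cong₂ _-_ (degree-δ-sym u v) (cong (λ b → if b then 1ℚ else 0ℚ) (adj-sym G u v)) ⟩
    degree G v * δ v u - A v u
      ≡⟨ sym (laplacian-entry v u) ⟩
    L v u ∎
    where open ≡-Reasoning

  laplacian-zeroRowSums : ZeroRowSums L
  laplacian-zeroRowSums u = begin
    Σ[ L u ]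
      ≡⟨ Σ-cong (λ v → trans (laplacian-entry u v) (expand (degree G u) (δ u v) (A u v))) ⟩
    Σ[ (λ v → degree G u * δ u v - 1ℚ * A u v) ]
      ≡⟨ Σ-linear (degree G u) 1ℚ (δ u) (A u) ⟩
    degree G u * Σ[ δ u ] - 1ℚ * degree G u
      ≡⟨ cong (λ x → degree G u * x - 1ℚ * degree G u) (Σ-δ u) ⟩
    degree G u * 1ℚ - 1ℚ * degree G u
      ≡⟨ cancel (degree G u) ⟩
    0ℚ ∎
    where
    open ≡-Reasoning
    expand : ∀ d x a → d * x - a ≡ d * x - 1ℚ * a
    expand = solve-∀ ℚ-ring
    cancel : ∀ d → d * 1ℚ - 1ℚ * d ≡ 0ℚ
    cancel = solve-∀ ℚ-ring

  laplacian-zeroColSums : ZeroRowSums (transpose L)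
  laplacian-zeroColSums v = trans (Σ-cong (λ u → laplacian-symmetric u v)) (laplacian-zeroRowSums v)

  laplacian-apply : ∀ (q : Fin n → ℚ) u → Σ[ (λ k → L u k * q k) ] ≡ Σ[ (λ k → A u k * (q u - q k)) ]
  laplacian-apply q u = begin
    Σ[ (λ k → L u k * q k) ]
      ≡⟨ Σ-cong (λ k → trans (cong (_* q k) (laplacian-entry u k)) (expandL d (δ u k) (A u k) (q k))) ⟩
    Σ[ (λ k → d * (δ u k * q k) - 1ℚ * (A u k * q k)) ]
      ≡⟨ Σ-linear d 1ℚ (λ k → δ u k * q k) (λ k → A u k * q k) ⟩
    d * Σ[ (λ k → δ u k * q k) ] - 1ℚ * Σ[ (λ k → A u k * q k) ]
      ≡⟨ cong (λ x → x - 1ℚ * Σ[ (λ k → A u k * q k) ]) (trans (cong (d *_) (Σ-δˡ u q)) (*-comm d (q u))) ⟩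
    q u * Σ[ A u ] - 1ℚ * Σ[ (λ k → A u k * q k) ]
      ≡⟨ sym (Σ-linear (q u) 1ℚ (A u) (λ k → A u k * q k)) ⟩
    Σ[ (λ k → q u * A u k - 1ℚ * (A u k * q k)) ]
      ≡⟨ Σ-cong (λ k → factor (q u) (A u k) (q k)) ⟩
    Σ[ (λ k → A u k * (q u - q k)) ] ∎
    where
    open ≡-Reasoning
    d : ℚ
    d = degree G u
    expandL : ∀ d e a x → (d * e - a) * x ≡ d * (e * x) - 1ℚ * (a * x)
    expandL = solve-∀ ℚ-ring
    factor : ∀ y a x → y * a - 1ℚ * (a * x) ≡ a * (y - x)
    factor = solve-∀ ℚ-ring

argmax : ∀ {n} (q : Fin (suc n) → ℚ) → ∃ λ u → ∀ v → q v ≤ q u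
argmax {ℕ.zero} q = zero , λ { zero → ≤-refl }
argmax {suc n} q with argmax (λ i → q (suc i))
... | u , q≤qu with ≤-total (q zero) (q (suc u))
...   | inj₁ q₀≤ = suc u , λ { zero → q₀≤ ; (suc v) → q≤qu v }
...   | inj₂ ≤q₀ = zero , λ { zero → ≤-refl ; (suc v) → ≤-trans (q≤qu v) ≤q₀ }

module ConnectedLaplacian {m : ℕ} (G : Graph (suc m)) (connected : Connected G) where

  open Laplacian G

  -- Maximum principle: at a maximum w of q the terms A(w,k)(q w − q k) of (Lq)(w) = 0 are
  -- nonnegative, so every neighbour of w is a maximum too; connectivity spreads this to all vertices.
  harmonic⇒constant : ∀ (q : Fin (suc m) → ℚ) → (∀ u → Σ[ (λ k → L u k * q k) ] ≡ 0ℚ) → ∀ u v → q u ≡ q v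
  harmonic⇒constant q Lq≡0 u v = trans (along refl (connected top u)) (sym (along refl (connected top v)))
    where
    top : Fin (suc m)
    top = proj₁ (argmax q)
    q≤top : ∀ v → q v ≤ q top
    q≤top = proj₂ (argmax q)
    neighbour : ∀ {w w′} → q w ≡ q top → adj G w w′ ≡ true → q w′ ≡ q top
    neighbour {w} {w′} qw≡max w~w′ = trans (sym (p-q≡0⇒p≡q (q w) (q w′) difference≡0)) qw≡max
      where
      terms≥0 : ∀ k → 0ℚ ≤ A w k * (q w - q k)
      terms≥0 k = *-nonNeg (adjacency-nonNeg w k) (p≤q⇒0≤q-p (subst (q k ≤_) (sym qw≡max) (q≤top k)))
      term≡0 : A w w′ * (q w - q w′) ≡ 0ℚ
      term≡0 = Σ-nonNeg-≡0 _ terms≥0 (trans (sym (laplacian-apply q w)) (Lq≡0 w)) w′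
      difference≡0 : q w - q w′ ≡ 0ℚ
      difference≡0 =
        trans (sym (*-identityˡ _)) (subst (λ b → (if b then 1ℚ else 0ℚ) * (q w - q w′) ≡ 0ℚ) w~w′ term≡0)
    along : ∀ {w v} → q w ≡ q top → Walk G w v → q v ≡ q top
    along qw≡max stay = qw≡max
    along qw≡max (step w~w′ walk) = along (neighbour qw≡max w~w′) walk

  -- The rows of I − M are harmonic, hence constant; symmetry makes I − M a constant matrix,
  -- and the row sums of M pin the constant to 1/n.
  centering-unique : ∀ {M : Matrix (suc m)} → Symmetric M → (∀ i j → (M ⊗ L) i j ≡ L i j) → ZeroRowSums M →
    ∀ i j → M i j ≡ centering i j
  centering-unique {M} M-sym M⊗L≡L rowSums≡0 i j =
    trans (complement (M i j) (δ i j)) (cong (λ x → δ i j - x) (trans (Q-constant i j) c≡1/[1+m]))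
    where
    complement : ∀ x d → x ≡ d - (d - x)
    complement = solve-∀ ℚ-ring
    Q : Matrix (suc m)
    Q a b = δ a b - M a b
    Q-harmonic : ∀ a c → Σ[ (λ l → L c l * Q a l) ] ≡ 0ℚ
    Q-harmonic a c = begin
      Σ[ (λ l → L c l * (δ a l - M a l)) ]
        ≡⟨ Σ-cong (λ l → trans (distrib (L c l) (δ a l) (M a l))
                               (cong (λ x → δ a l * L c l - M a l * x) (laplacian-symmetric c l))) ⟩
      Σ[ (λ l → δ a l * L c l - M a l * L l c) ]
        ≡⟨ Σ-distrib-- (λ l → δ a l * L c l) (λ l → M a l * L l c) ⟩
      Σ[ (λ l → δ a l * L c l) ] - (M ⊗ L) a c
        ≡⟨ cong₂ _-_ (Σ-δˡ a (L c)) (trans (M⊗L≡L a c) (laplacian-symmetric a c)) ⟩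
      L c a - L c a
        ≡⟨ +-inverseʳ (L c a) ⟩
      0ℚ ∎
      where
      open ≡-Reasoning
      distrib : ∀ a d x → a * (d - x) ≡ d * a - x * a
      distrib = solve-∀ ℚ-ring
    Q-constant : ∀ a b → Q a b ≡ Q zero zero
    Q-constant a b = begin
      Q a b         ≡⟨ harmonic⇒constant (Q a) (Q-harmonic a) b zero ⟩
      Q a zero      ≡⟨ cong₂ _-_ (δ-sym a zero) (M-sym a zero) ⟩
      Q zero a      ≡⟨ harmonic⇒constant (Q zero) (Q-harmonic zero) a zero ⟩
      Q zero zero   ∎
      where open ≡-Reasoning
    N*c≡1 : toℚ (suc m) * Q zero zero ≡ 1ℚ
    N*c≡1 = begin
      toℚ (suc m) * Q zero zero                 ≡⟨ sym (Σ-const {suc m} (Q zero zero)) ⟩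
      Σ[ (λ (_ : Fin (suc m)) → Q zero zero) ]  ≡⟨ Σ-cong {suc m} (λ b → sym (Q-constant zero b)) ⟩
      Σ[ Q zero ]                               ≡⟨ Σ-distrib-- {suc m} (δ zero) (M zero) ⟩
      Σ[ δ {suc m} zero ] - Σ[ M zero ]         ≡⟨ cong₂ _-_ (Σ-δ {suc m} zero) (rowSums≡0 zero) ⟩
      1ℚ - 0ℚ                                   ≡⟨ +-identityʳ 1ℚ ⟩
      1ℚ                                        ∎
      where open ≡-Reasoning
    c≡1/[1+m] : Q zero zero ≡ 1/[1+ m ]
    c≡1/[1+m] = *-cancelˡ-≡-pos (toℚ (suc m)) {{toℚ-suc-pos m}} (trans N*c≡1 (sym (toℚ-suc*1/[1+] m)))

laplacian-complete : ∀ {m} (G : Graph (suc m)) → (∀ u v → u ≢ v → adj G u v ≡ true) →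
  ∀ u v → laplacian G u v ≡ toℚ (suc m) * centering u v
laplacian-complete {m} G complete u v = begin
  L u v
    ≡⟨ laplacian-entry u v ⟩
  degree G u * δ u v - A u v
    ≡⟨ cong₂ (λ d a → d * δ u v - a) degree≡m (adjacency≡1-δ u v) ⟩
  toℚ m * δ u v - (1ℚ - δ u v)
    ≡⟨ collect (toℚ m) (δ u v) ⟩
  (1ℚ + toℚ m) * δ u v - 1ℚ
    ≡⟨ cong (λ x → (1ℚ + toℚ m) * δ u v - x) (sym (toℚ-suc*1/[1+] m)) ⟩
  (1ℚ + toℚ m) * δ u v - (1ℚ + toℚ m) * 1/[1+ m ]
    ≡⟨ factor (1ℚ + toℚ m) (δ u v) 1/[1+ m ] ⟩
  toℚ (suc m) * centering u v ∎
  where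
  open ≡-Reasoning
  open Laplacian G
  adjacency≡1-δ : ∀ u v → A u v ≡ 1ℚ - δ u v
  adjacency≡1-δ u v with u ≟ v
  ... | yes refl rewrite adj-irrefl G u = sym (+-inverseʳ 1ℚ)
  ... | no u≢v   rewrite complete u v u≢v = sym (+-identityʳ 1ℚ)
  degree≡m : degree G u ≡ toℚ m
  degree≡m = begin
    Σ[ A u ]                                    ≡⟨ Σ-cong (adjacency≡1-δ u) ⟩
    Σ[ (λ v → 1ℚ - δ u v) ]                     ≡⟨ Σ-distrib-- (λ _ → 1ℚ) (δ u) ⟩
    Σ[ (λ (_ : Fin (suc m)) → 1ℚ) ] - Σ[ δ u ]  ≡⟨ cong₂ _-_ (Σ-const {suc m} 1ℚ) (Σ-δ u) ⟩
    (1ℚ + toℚ m) * 1ℚ - 1ℚ                      ≡⟨ drop-one (toℚ m) ⟩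
    toℚ m                                       ∎
    where
    drop-one : ∀ t → (1ℚ + t) * 1ℚ - 1ℚ ≡ t
    drop-one = solve-∀ ℚ-ring
  collect : ∀ t d → t * d - (1ℚ - d) ≡ (1ℚ + t) * d - 1ℚ
  collect = solve-∀ ℚ-ring
  factor : ∀ n d w → n * d - n * w ≡ n * (d - w)
  factor = solve-∀ ℚ-ring

-- Kirchhoff and biharmonic indices

-- kirchhoff X is, by its definition, Σ² (upper (resistance X)).
upper : ∀ {n} → Matrix n → Matrix n
upper M i j = if does (i <? j) then M i j else 0ℚ

upper-< : ∀ {n} (M : Matrix n) {i j} → i <ᶠ j → upper M i j ≡ M i j
upper-< M {i} {j} i<j = cong (λ b → if b then M i j else 0ℚ) (dec-true (i <? j) i<j)

upper-≮ : ∀ {n} (M : Matrix n) {i j} → ¬ i <ᶠ j → upper M i j ≡ 0ℚ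
upper-≮ M {i} {j} i≮j = cong (λ b → if b then M i j else 0ℚ) (dec-false (i <? j) i≮j)

upper+upperᵀ : ∀ {n} {M : Matrix n} → Symmetric M → (∀ i → M i i ≡ 0ℚ) →
  ∀ i j → upper M i j + upper M j i ≡ M i j
upper+upperᵀ {M = M} M-sym diag≡0 i j with Fin.<-cmp i j
... | tri< i<j _ j≮i  = trans (cong₂ _+_ (upper-< M i<j) (upper-≮ M j≮i)) (+-identityʳ (M i j))
... | tri> i≮j _ j<i  = trans (cong₂ _+_ (upper-≮ M i≮j) (upper-< M j<i)) (trans (+-identityˡ (M j i)) (M-sym j i))
... | tri≈ i≮i refl _ = trans (cong₂ _+_ (upper-≮ M i≮i) (upper-≮ M i≮i)) (trans (+-identityʳ 0ℚ) (sym (diag≡0 i)))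

Σ²-upper : ∀ {n} {M : Matrix n} → Symmetric M → (∀ i → M i i ≡ 0ℚ) → Σ² (upper M) + Σ² (upper M) ≡ Σ² M
Σ²-upper {M = M} M-sym diag≡0 = begin
  Σ² (upper M) + Σ² (upper M)
    ≡⟨ cong (_+_ (Σ² (upper M))) (Σ-comm (upper M)) ⟩
  Σ² (upper M) + Σ² (λ i j → upper M j i)
    ≡⟨ sym (Σ-distrib-+ (λ i → Σ[ upper M i ]) (λ i → Σ[ (λ j → upper M j i) ])) ⟩
  Σ[ (λ i → Σ[ upper M i ] + Σ[ (λ j → upper M j i) ]) ]
    ≡⟨ Σ-cong (λ i → sym (Σ-distrib-+ (upper M i) (λ j → upper M j i))) ⟩
  Σ² (λ i j → upper M i j + upper M j i)
    ≡⟨ Σ-cong (λ i → Σ-cong (upper+upperᵀ M-sym diag≡0 i)) ⟩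
  Σ² M ∎
  where open ≡-Reasoning

Σ²-resistance : ∀ {n} (Z : Matrix n) → ZeroRowSums Z → Σ² (resistance Z) ≡ toℚ n * trace Z + toℚ n * trace Z
Σ²-resistance {n} Z rowSums≡0 = begin
  Σ[ (λ i → Σ[ resistance Z i ]) ]
    ≡⟨ Σ-cong row ⟩
  Σ[ (λ i → toℚ n * Z i i + trace Z) ]
    ≡⟨ Σ-distrib-+ (λ i → toℚ n * Z i i) (λ _ → trace Z) ⟩
  Σ[ (λ i → toℚ n * Z i i) ] + Σ[ (λ (_ : Fin n) → trace Z) ]
    ≡⟨ cong₂ _+_ (sym (*-distribˡ-Σ (toℚ n) (λ i → Z i i))) (Σ-const {n} (trace Z)) ⟩
  toℚ n * trace Z + toℚ n * trace Z ∎
  where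
  open ≡-Reasoning
  drop : ∀ x y c → x + y - c * 0ℚ ≡ x + y
  drop = solve-∀ ℚ-ring
  row : ∀ i → Σ[ resistance Z i ] ≡ toℚ n * Z i i + trace Z
  row i = begin
    Σ[ (λ j → Z i i + Z j j - (+ 2 / 1) * Z i j) ]
      ≡⟨ Σ-distrib-- (λ j → Z i i + Z j j) (λ j → (+ 2 / 1) * Z i j) ⟩
    Σ[ (λ j → Z i i + Z j j) ] - Σ[ (λ j → (+ 2 / 1) * Z i j) ]
      ≡⟨ cong₂ _-_ (trans (Σ-distrib-+ (λ _ → Z i i) (λ j → Z j j)) (cong (_+ trace Z) (Σ-const {n} (Z i i))))
                   (sym (*-distribˡ-Σ (+ 2 / 1) (Z i))) ⟩
    toℚ n * Z i i + trace Z - (+ 2 / 1) * Σ[ Z i ]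
      ≡⟨ cong (λ s → toℚ n * Z i i + trace Z - (+ 2 / 1) * s) (rowSums≡0 i) ⟩
    toℚ n * Z i i + trace Z - (+ 2 / 1) * 0ℚ
      ≡⟨ drop (toℚ n * Z i i) (trace Z) (+ 2 / 1) ⟩
    toℚ n * Z i i + trace Z ∎

kirchhoff≡n*trace : ∀ {n} {X : Matrix n} → Symmetric X → ZeroRowSums X → kirchhoff X ≡ toℚ n * trace X
kirchhoff≡n*trace {X = X} X-sym rowSums≡0 =
  halve (trans (Σ²-upper resistance-sym resistance-diag) (Σ²-resistance X rowSums≡0))
  where
  resistance-sym : Symmetric (resistance X)
  resistance-sym i j = trans (cong (λ x → X i i + X j j - (+ 2 / 1) * x) (X-sym i j)) (swap (X i i) (X j j) (X j i))
    where
    swap : ∀ a b z → a + b - (+ 2 / 1) * z ≡ b + a - (+ 2 / 1) * z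
    swap = solve-∀ ℚ-ring
  resistance-diag : ∀ i → resistance X i i ≡ 0ℚ
  resistance-diag i = vanish (X i i)
    where
    vanish : ∀ a → a + a - (+ 2 / 1) * a ≡ 0ℚ
    vanish = solve-∀ ℚ-ring

-- biharmonicSq X unfolds to resistance (X ⊗ X).
biharmonicIndex≡n*trace : ∀ {n} {X : Matrix n} → ZeroRowSums X → biharmonicIndex X ≡ toℚ n * trace (X ⊗ X)
biharmonicIndex≡n*trace {X = X} rowSums≡0 =
  trans (cong (½ *_) (Σ²-resistance (X ⊗ X) (⊗-zeroRowSums X X rowSums≡0))) (half-double _)
  where
  half-double : ∀ x → ½ * (x + x) ≡ x
  half-double = solve-∀ ℚ-ring

-- The Moore–Penrose inverse of the Laplacian of a connected graph

module PseudoInverse {m : ℕ} (G : Graph (suc m)) (connected : Connected G)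
                     {X : Matrix (suc m)} (mp : IsMPInverse (laplacian G) X) where

  open Laplacian G
  open ConnectedLaplacian G connected
  open IsMPInverse mp

  L⊗X≡centering : ∀ i j → (L ⊗ X) i j ≡ centering i j
  L⊗X≡centering = centering-unique {M = L ⊗ X} L⊗X-symmetric p1
    (symmetric∧zeroColSums⇒zeroRowSums {M = L ⊗ X} L⊗X-symmetric (⊗-zeroColSums L X laplacian-zeroColSums))
    where
    L⊗X-symmetric : Symmetric (L ⊗ X)
    L⊗X-symmetric i j = sym (p3 i j)

  X⊗L≡centering : ∀ i j → (X ⊗ L) i j ≡ centering i j
  X⊗L≡centering = centering-unique {M = X ⊗ L} X⊗L-symmetric X⊗L⊗L≡L (⊗-zeroRowSums X L laplacian-zeroRowSums)
    where
    X⊗L-symmetric : Symmetric (X ⊗ L)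
    X⊗L-symmetric i j = sym (p4 i j)
    X⊗L⊗L≡L : ∀ i j → ((X ⊗ L) ⊗ L) i j ≡ L i j
    X⊗L⊗L≡L i j = begin
      ((X ⊗ L) ⊗ L) i j   ≡⟨ ⊗-swap-symmetric X⊗L-symmetric laplacian-symmetric i j ⟩
      (L ⊗ (X ⊗ L)) j i   ≡⟨ sym (⊗-assoc L X L j i) ⟩
      ((L ⊗ X) ⊗ L) j i   ≡⟨ p1 j i ⟩
      L j i               ≡⟨ laplacian-symmetric j i ⟩
      L i j               ∎
      where open ≡-Reasoning

  -- The rows of X − Xᵀ are harmonic because X ⊗ L and L ⊗ X are both the centering matrix.
  pinv-symmetric : Symmetric X
  pinv-symmetric i j = p-q≡0⇒p≡q (X i j) (X j i) (trans (harmonic⇒constant D D-harmonic j i) (+-inverseʳ (X i i)))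
    where
    D : Fin (suc m) → ℚ
    D l = X i l - X l i
    D-harmonic : ∀ c → Σ[ (λ l → L c l * D l) ] ≡ 0ℚ
    D-harmonic c = begin
      Σ[ (λ l → L c l * (X i l - X l i)) ]
        ≡⟨ Σ-cong (λ l → trans (distrib (L c l) (X i l) (X l i))
                               (cong (λ x → X i l * x - L c l * X l i) (laplacian-symmetric c l))) ⟩
      Σ[ (λ l → X i l * L l c - L c l * X l i) ]
        ≡⟨ Σ-distrib-- (λ l → X i l * L l c) (λ l → L c l * X l i) ⟩
      (X ⊗ L) i c - (L ⊗ X) c i
        ≡⟨ cong₂ _-_ (X⊗L≡centering i c) (trans (L⊗X≡centering c i) (centering-symmetric c i)) ⟩
      centering i c - centering i c
        ≡⟨ +-inverseʳ (centering i c) ⟩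
      0ℚ ∎
      where
      open ≡-Reasoning
      distrib : ∀ a x y → a * (x - y) ≡ x * a - a * y
      distrib = solve-∀ ℚ-ring

  centering⊗X≡X : ∀ i j → (centering ⊗ X) i j ≡ X i j
  centering⊗X≡X i j = trans (sym (⊗-cong {B = X} {B′ = X} X⊗L≡centering (λ _ _ → refl) i j)) (p2 i j)

  pinv-zeroRowSums : ZeroRowSums X
  pinv-zeroRowSums = symmetric∧zeroColSums⇒zeroRowSums {M = X} pinv-symmetric colSums≡0
    where
    colSums≡0 : ZeroRowSums (transpose X)
    colSums≡0 j = *-cancelˡ-≡-pos 1/[1+ m ] {{1/[1+]-pos m}} (trans w*colSum≡0 (sym (*-zeroʳ 1/[1+ m ])))
      where
      w*colSum≡0 : 1/[1+ m ] * Σ[ (λ l → X l j) ] ≡ 0ℚ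
      w*colSum≡0 = p-q≡p⇒q≡0 (X zero j) _ (trans (sym (centering-⊗ X zero j)) (centering⊗X≡X zero j))

  kirchhoff≡ : kirchhoff X ≡ toℚ (suc m) * ⟪ X , centering ⟫
  kirchhoff≡ = trans (kirchhoff≡n*trace {X = X} pinv-symmetric pinv-zeroRowSums)
                     (cong (toℚ (suc m) *_) (sym (⟪⟫-centering {M = X} pinv-zeroRowSums)))

  biharmonicIndex≡ : biharmonicIndex X ≡ toℚ (suc m) * ⟪ X , X ⟫
  biharmonicIndex≡ = trans (biharmonicIndex≡n*trace {X = X} pinv-zeroRowSums)
                           (cong (toℚ (suc m) *_) (sym (⟪⟫≡trace-⊗ X pinv-symmetric)))

  -- Multiplying k X = t E on the left by L gives k E = t L, but E vanishes nowhere off the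
  -- diagonal while L vanishes at every non-edge.
  proportional⇒complete : ∀ k t → Positive k → (∀ i j → k * X i j ≡ t * centering i j) →
    ∀ u v → u ≢ v → adj G u v ≡ true
  proportional⇒complete k t k>0 kX≡tE u v u≢v with adj G u v in u~v
  ... | true  = refl
  ... | false = ⊥-elim (<-irrefl (sym 1/[1+m]≡0) (positive⁻¹ 1/[1+ m ] {{1/[1+]-pos m}}))
    where
    open ≡-Reasoning
    kE≡tL : ∀ i j → k * centering i j ≡ t * L i j
    kE≡tL i j = begin
      k * centering i j
        ≡⟨ cong (k *_) (sym (L⊗X≡centering i j)) ⟩
      k * (L ⊗ X) i j
        ≡⟨ sym (⊗-scaleʳ k L X i j) ⟩
      (L ⊗ (λ a b → k * X a b)) i j
        ≡⟨ ⊗-cong {A = L} {A′ = L} (λ _ _ → refl) kX≡tE i j ⟩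
      (L ⊗ (λ a b → t * centering a b)) i j
        ≡⟨ ⊗-scaleʳ t L centering i j ⟩
      t * (L ⊗ centering) i j
        ≡⟨ cong (t *_) (⊗-centering-zeroRowSums {M = L} laplacian-zeroRowSums i j) ⟩
      t * L i j ∎
    Luv≡0 : L u v ≡ 0ℚ
    Luv≡0 = begin
      L u v
        ≡⟨ laplacian-entry u v ⟩
      degree G u * δ u v - A u v
        ≡⟨ cong₂ (λ d a → degree G u * d - a) (δ-offdiag u≢v) (cong (λ b → if b then 1ℚ else 0ℚ) u~v) ⟩
      degree G u * 0ℚ - 0ℚ
        ≡⟨ vanish (degree G u) ⟩
      0ℚ ∎
      where
      vanish : ∀ d → d * 0ℚ - 0ℚ ≡ 0ℚ
      vanish = solve-∀ ℚ-ring
    Euv≡0 : centering u v ≡ 0ℚ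
    Euv≡0 = *-cancelˡ-≡-pos k {{k>0}} (trans (kE≡tL u v) (trans (cong (t *_) Luv≡0) (trans (*-zeroʳ t) (sym (*-zeroʳ k)))))
    1/[1+m]≡0 : 1/[1+ m ] ≡ 0ℚ
    1/[1+m]≡0 = trans (sym (p-q≡0⇒p≡q (δ u v) 1/[1+ m ] Euv≡0)) (δ-offdiag u≢v)

  -- For the complete graph L = n E, so E = L X = n (E X) = n X.
  complete⇒proportional : (∀ u v → u ≢ v → adj G u v ≡ true) → ∀ i j → X i j ≡ 1/[1+ m ] * centering i j
  complete⇒proportional complete i j = begin
    X i j
      ≡⟨ sym (*-identityˡ (X i j)) ⟩
    1ℚ * X i j
      ≡⟨ cong (_* X i j) (sym (trans (*-comm 1/[1+ m ] (toℚ (suc m))) (toℚ-suc*1/[1+] m))) ⟩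
    1/[1+ m ] * toℚ (suc m) * X i j
      ≡⟨ *-assoc 1/[1+ m ] (toℚ (suc m)) (X i j) ⟩
    1/[1+ m ] * (toℚ (suc m) * X i j)
      ≡⟨ cong (1/[1+ m ] *_) (sym E≡N*X) ⟩
    1/[1+ m ] * centering i j ∎
    where
    open ≡-Reasoning
    E≡N*X : centering i j ≡ toℚ (suc m) * X i j
    E≡N*X = begin
      centering i j
        ≡⟨ sym (L⊗X≡centering i j) ⟩
      (L ⊗ X) i j
        ≡⟨ ⊗-cong {B = X} {B′ = X} (laplacian-complete G complete) (λ _ _ → refl) i j ⟩
      ((λ a b → toℚ (suc m) * centering a b) ⊗ X) i j
        ≡⟨ ⊗-scaleˡ (toℚ (suc m)) centering X i j ⟩
      toℚ (suc m) * (centering ⊗ X) i j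
        ≡⟨ cong (toℚ (suc m) *_) (centering⊗X≡X i j) ⟩
      toℚ (suc m) * X i j ∎

isomorphic-complete⇒adjacent : ∀ {n} {G : Graph n} → Isomorphic G (completeGraph n) →
  ∀ u v → u ≢ v → adj G u v ≡ true
isomorphic-complete⇒adjacent (σ , adj≡) u v u≢v =
  trans (adj≡ u v) (cong (λ b → if b then false else true) (dec-false (to u ≟ to v) σu≢σv))
  where
  open Inverse σ using (to)
  open Injection (↔⇒↣ σ) using (injective)
  σu≢σv : to u ≢ to v
  σu≢σv σu≡σv = u≢v (injective σu≡σv)

adjacent⇒isomorphic-complete : ∀ {n} {G : Graph n} → (∀ u v → u ≢ v → adj G u v ≡ true) →
  Isomorphic G (completeGraph n)
adjacent⇒isomorphic-complete {n} {G} complete = ↔-id (Fin n) , adj≡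
  where
  adj≡ : ∀ u v → adj G u v ≡ adj (completeGraph n) u v
  adj≡ u v with u ≟ v
  ... | yes refl = adj-irrefl G u
  ... | no u≢v   = complete u v u≢v

1/[n[n-1]]*n*[n-1]≡1 : ∀ m → (+ 1 / (suc (suc m) ℕ.* suc m)) * (toℚ (suc (suc m)) * toℚ (suc m)) ≡ 1ℚ
1/[n[n-1]]*n*[n-1]≡1 m =
  trans (cong (+ 1 / (suc (suc m) ℕ.* suc m) *_) (sym (toℚ-* (suc (suc m)) (suc m)))) (1/n*n≡1 (suc (suc m) ℕ.* suc m))

rescale : ∀ N k c t f → c * (N * k) ≡ 1ℚ →
  (N * t) * (N * t) * c ≡ (c * N * N) * (t * t) × N * f ≡ (c * N * N) * (k * f)
rescale N k c t f c*N*k≡1 = rearrange N t c , (begin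
  N * f                    ≡⟨ sym (*-identityʳ (N * f)) ⟩
  N * f * 1ℚ               ≡⟨ cong (N * f *_) (sym c*N*k≡1) ⟩
  N * f * (c * (N * k))    ≡⟨ regroup N f c k ⟩
  (c * N * N) * (k * f)    ∎)
  where
  open ≡-Reasoning
  rearrange : ∀ N t c → (N * t) * (N * t) * c ≡ (c * N * N) * (t * t)
  rearrange = solve-∀ ℚ-ring
  regroup : ∀ N f c k → N * f * (c * (N * k)) ≡ (c * N * N) * (k * f)
  regroup = solve-∀ ℚ-ring

theorem4p3 : (m : ℕ) → (G : Graph (suc (suc m))) → Connected G →
    (Lplus : Matrix (suc (suc m))) → IsMPInverse (laplacian G) Lplus →
    ((kirchhoff Lplus * kirchhoff Lplus) * ((+ 1) / (suc (suc m) ℕ.* suc m)) ≤ biharmonicIndex Lplus)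
    × ((biharmonicIndex Lplus ≡ (kirchhoff Lplus * kirchhoff Lplus) * ((+ 1) / (suc (suc m) ℕ.* suc m)))
    ⇔ Isomorphic G (completeGraph (suc (suc m))))
theorem4p3 m G connected X mp = inequality , mk⇔ tight⇒complete complete⇒tight
  where
  open PseudoInverse G connected mp
  N c s : ℚ
  N = toℚ (suc (suc m))
  c = (+ 1) / (suc (suc m) ℕ.* suc m)
  s = c * N * N
  E : Matrix (suc (suc m))
  E = centering
  s-pos : Positive s
  s-pos = pos*pos⇒pos (c * N) {{pos*pos⇒pos c {{c-pos}} N {{N-pos}}}} N {{N-pos}}
    where
    c-pos : Positive c
    c-pos = normalize-pos 1 (suc (suc m) ℕ.* suc m)
    N-pos : Positive N
    N-pos = toℚ-suc-pos (suc m)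
  ⟪E,E⟫-pos : Positive ⟪ E , E ⟫
  ⟪E,E⟫-pos = subst Positive (sym (⟪centering,centering⟫ {suc m})) (toℚ-suc-pos m)
  normalised : c * (N * ⟪ E , E ⟫) ≡ 1ℚ
  normalised = subst (λ k → c * (N * k) ≡ 1ℚ) (sym (⟪centering,centering⟫ {suc m})) (1/[n[n-1]]*n*[n-1]≡1 m)
  Kf²c≡ : kirchhoff X * kirchhoff X * c ≡ s * (⟪ X , E ⟫ * ⟪ X , E ⟫)
  Kf²c≡ = trans (cong (λ K → K * K * c) kirchhoff≡) (proj₁ (rescale N ⟪ E , E ⟫ c ⟪ X , E ⟫ ⟪ X , X ⟫ normalised))
  B≡ : biharmonicIndex X ≡ s * (⟪ E , E ⟫ * ⟪ X , X ⟫)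
  B≡ = trans biharmonicIndex≡ (proj₂ (rescale N ⟪ E , E ⟫ c ⟪ X , E ⟫ ⟪ X , X ⟫ normalised))
  inequality : kirchhoff X * kirchhoff X * c ≤ biharmonicIndex X
  inequality = subst₂ _≤_ (sym Kf²c≡) (sym B≡)
    (*-monoˡ-≤-nonNeg s {{pos⇒nonNeg s {{s-pos}}}} (cauchy-schwarz X E (positive⁻¹ _ {{⟪E,E⟫-pos}})))
  tight⇒complete : biharmonicIndex X ≡ kirchhoff X * kirchhoff X * c → Isomorphic G (completeGraph (suc (suc m)))
  tight⇒complete B≡Kf²c = adjacent⇒isomorphic-complete {G = G}
    (proportional⇒complete ⟪ E , E ⟫ ⟪ X , E ⟫ ⟪E,E⟫-pos
    (cauchy-schwarz-≡ X E (*-cancelˡ-≡-pos s {{s-pos}} (trans (sym Kf²c≡) (trans (sym B≡Kf²c) B≡)))))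
  complete⇒tight : Isomorphic G (completeGraph (suc (suc m))) → biharmonicIndex X ≡ kirchhoff X * kirchhoff X * c
  complete⇒tight iso = trans B≡ (trans (cong (s *_) (sym tight)) (sym Kf²c≡))
    where
    tight : ⟪ X , E ⟫ * ⟪ X , E ⟫ ≡ ⟪ E , E ⟫ * ⟪ X , X ⟫
    tight = cauchy-schwarz-proportional 1/[1+ suc m ] X E (complete⇒proportional (isomorphic-complete⇒adjacent {G = G} iso))
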